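{- $\mathrm{GL}_6(\mathbb{F}_2)$ does not contain a subgroup isomorphic to $\mathrm{PSL}_2(\mathbb{F}_8)\times C_2$. -}

module Defs where

open import Data.Bool using (Bool; true; false; _xor_; _∧_)
open import Data.Fin using (Fin; zero; suc)
open import Data.Vec using (Vec; tabulate; lookup; foldr; zipWith)
open import Data.Product using (_×_; _,_; Σ)
open import Data.Sum using (_⊎_)
open import Relation.Binary.PropositionalEquality using (_≡_)

Mat6 : Set
Mat6 = Vec (Vec Bool 6) 6

_·₆_ : Mat6 → Mat6 → Mat6
M ·₆ N = tabulate λ i → tabulate λ j →
  foldr (λ _ → Bool) _xor_ false
    (zipWith _∧_ (lookup M i) (tabulate λ k → lookup (lookup N k) j))

δ : ∀ {n} → Fin n → Fin n → Bool
δ zero    zero    = true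
δ zero    (suc j) = false
δ (suc i) zero    = false
δ (suc i) (suc j) = δ i j

I₆ : Mat6
I₆ = tabulate λ i → tabulate λ j → δ i j

InGL6 : Mat6 → Set
InGL6 M = Σ Mat6 λ N → (M ·₆ N ≡ I₆) × (N ·₆ M ≡ I₆)

-- The field F₈ = F₂[x]/(x³ + x + 1); element a₀ + a₁x + a₂x² is (a₀ , a₁ , a₂).

F8 : Set
F8 = Bool × Bool × Bool

0F8 : F8
0F8 = false , false , false

1F8 : F8
1F8 = true , false , false

_+₈_ : F8 → F8 → F8
(a0 , a1 , a2) +₈ (b0 , b1 , b2) = (a0 xor b0) , (a1 xor b1) , (a2 xor b2)

-- additive inverse (characteristic 2: -a = a)
-₈_ : F8 → F8
-₈ (a0 , a1 , a2) = a0 , a1 , a2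

-- multiplication, reducing with x³ = x + 1, x⁴ = x² + x
_*₈_ : F8 → F8 → F8
(a0 , a1 , a2) *₈ (b0 , b1 , b2) =
  let c0 = a0 ∧ b0
      c1 = (a0 ∧ b1) xor (a1 ∧ b0)
      c2 = ((a0 ∧ b2) xor (a1 ∧ b1)) xor (a2 ∧ b0)
      c3 = (a1 ∧ b2) xor (a2 ∧ b1)
      c4 = a2 ∧ b2
  in (c0 xor c3) , ((c1 xor c3) xor c4) , (c2 xor c4)

record M2 : Set where
  constructor mat2
  field
    a b c d : F8

_·₂_ : M2 → M2 → M2
mat2 a b c d ·₂ mat2 a' b' c' d' =
  mat2 ((a *₈ a') +₈ (b *₈ c')) ((a *₈ b') +₈ (b *₈ d'))
       ((c *₈ a') +₈ (d *₈ c')) ((c *₈ b') +₈ (d *₈ d'))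

det2 : M2 → F8
det2 (mat2 a b c d) = (a *₈ d) +₈ (-₈ (b *₈ c))

-₂_ : M2 → M2
-₂ (mat2 a b c d) = mat2 (-₈ a) (-₈ b) (-₈ c) (-₈ d)

IsSL2 : M2 → Set
IsSL2 A = det2 A ≡ 1F8

-- equality in PSL₂(F₈) of (representatives) A, B ∈ SL₂(F₈): A = ±B
_≈PSL_ : M2 → M2 → Set
A ≈PSL B = (A ≡ B) ⊎ (A ≡ -₂ B)

-- PSL₂(F₈) × C₂, with C₂ = (Bool, xor).  An element is a pair (A , s)
-- with A ∈ SL₂(F₈) representing its class in PSL₂(F₈).
--
-- "GL₆(F₂) contains a subgroup isomorphic to PSL₂(F₈) × C₂"
-- ⇔ there is an injective group homomorphism PSL₂(F₈) × C₂ → GL₆(F₂).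

record EmbeddingIntoGL6 : Set where
  field
    φ : M2 → Bool → Mat6
    φ-wd    : ∀ A B s → IsSL2 A → IsSL2 B → A ≈PSL B → φ A s ≡ φ B s
    φ-GL    : ∀ A s → IsSL2 A → InGL6 (φ A s)
    φ-hom   : ∀ A B s t → IsSL2 A → IsSL2 B →
              φ (A ·₂ B) (s xor t) ≡ φ A s ·₆ φ B t
    φ-inj   : ∀ A B s t → IsSL2 A → IsSL2 B →
              φ A s ≡ φ B t → (A ≈PSL B) × (s ≡ t)

module Submission where

-- A faithful representation of PSL₂(F₈) × C₂ on V = F₂⁶ sends an element of order 9 in PSL₂(F₈)
-- to an additive map h with h⁹ = 1 ≠ h³, so some nonzero vector (h³ + 1)z is killed by
-- Φ₉(h) = h⁶ + h³ + 1. Since Φ₉ is irreducible of degree 6 over F₂, any such vector x is cyclic: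
-- r ↦ r(h)x identifies the field F₂[X]/(Φ₉) with V, which forces Φ₉(h) = 0 on all of V. The
-- central involution c commutes with h, so c + 1 is F₂[h]-linear; it kills the cyclic vector
-- cu + u for any u with cu ≠ u, hence vanishes, contradicting c ≠ 1. The two facts about
-- F₂[X]/(Φ₉) that are needed (nonzero elements are invertible, X³ fixes only 0) are checked by
-- exhaustion over its 64 elements.

open import Defs
open import Algebra.Bundles using (CommutativeMonoid; CommutativeRing)
import Algebra.Properties.CommutativeSemigroup as CommutativeSemigroupProperties
import Algebra.Solver.CommutativeMonoid as CommutativeMonoidSolver
open import Data.Bool using (Bool; true; false; _xor_; _∧_; if_then_else_)
import Data.Bool.Properties as Bool
open import Data.Empty using (⊥-elim)
open import Data.Fin using (Fin; zero; suc; combine; remQuot)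
import Data.Fin.Properties as Fin
open import Data.Nat using (ℕ; zero; suc)
import Data.Nat as ℕ
open import Data.Nat.Properties using (n<1+n)
open import Data.Product using (Σ; ∃; _×_; _,_; proj₁; proj₂)
open import Data.Sum using (_⊎_; inj₁; inj₂)
open import Data.Vec using (Vec; []; _∷_; tabulate; lookup; foldr; zipWith; replicate)
open import Data.Vec.Properties
  using (lookup∘tabulate; tabulate∘lookup; tabulate-cong; zipWith-assoc; zipWith-comm;
         zipWith-identityˡ; zipWith-identityʳ; ≡-dec)
open import Function.Base using (_∘_)
open import Function.Bundles using (_↔_; mk↔ₛ′; Inverse)
open import Function.Endo.Propositional (Vec Bool 6) using (_^_)
open import Level using (0ℓ)
open import Relation.Binary.PropositionalEquality
open import Relation.Nullary using (Dec; yes; no; ¬_)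
open import Relation.Nullary.Decidable using (True; toWitness; map′; _⊎-dec_; _→-dec_)
open import Relation.Unary using (Decidable)

private
  variable
    k m n : ℕ

infixl 6 _⊕_
infixr 7 _·_

_⊕_ : Vec Bool n → Vec Bool n → Vec Bool n
_⊕_ = zipWith _xor_

0ᵥ : Vec Bool n
0ᵥ = replicate _ false

_·_ : Bool → Vec Bool n → Vec Bool n
b · v = if b then v else 0ᵥ

⊕-commutativeMonoid : ℕ → CommutativeMonoid 0ℓ 0ℓ
⊕-commutativeMonoid n = record
  { Carrier = Vec Bool n
  ; _≈_ = _≡_
  ; _∙_ = _⊕_
  ; ε = 0ᵥ
  ; isCommutativeMonoid = record
    { isMonoid = record
      { isSemigroup = record
        { isMagma = record { isEquivalence = isEquivalence ; ∙-cong = cong₂ _⊕_ }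
        ; assoc = zipWith-assoc Bool.xor-assoc
        }
      ; identity = zipWith-identityˡ Bool.xor-identityˡ , zipWith-identityʳ Bool.xor-identityʳ
      }
    ; comm = zipWith-comm Bool.xor-comm
    }
  }

module _ {n : ℕ} where
  open CommutativeMonoid (⊕-commutativeMonoid n) public
    using () renaming (assoc to ⊕-assoc; comm to ⊕-comm; identityʳ to ⊕-identityʳ)
  open CommutativeSemigroupProperties (CommutativeMonoid.commutativeSemigroup (⊕-commutativeMonoid n)) public
    using () renaming (interchange to ⊕-interchange)

⊕-self : (v : Vec Bool n) → v ⊕ v ≡ 0ᵥ
⊕-self []      = refl
⊕-self (x ∷ v) = cong₂ _∷_ (Bool.xor-same x) (⊕-self v)

⊕≡0⇒≡ : (u v : Vec Bool n) → u ⊕ v ≡ 0ᵥ → u ≡ v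
⊕≡0⇒≡ u v u⊕v≡0 = begin
  u            ≡⟨ ⊕-identityʳ u ⟨
  u ⊕ 0ᵥ       ≡⟨ cong (u ⊕_) (⊕-self v) ⟨
  u ⊕ (v ⊕ v)  ≡⟨ ⊕-assoc u v v ⟨
  u ⊕ v ⊕ v    ≡⟨ cong (_⊕ v) u⊕v≡0 ⟩
  0ᵥ ⊕ v       ≡⟨ zipWith-identityˡ Bool.xor-identityˡ v ⟩
  v            ∎
  where open ≡-Reasoning

·-distribʳ-xor : ∀ a b (v : Vec Bool n) → (a xor b) · v ≡ a · v ⊕ b · v
·-distribʳ-xor false b     v = sym (zipWith-identityˡ Bool.xor-identityˡ (b · v))
·-distribʳ-xor true  false v = sym (⊕-identityʳ v)
·-distribʳ-xor true  true  v = sym (⊕-self v)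

·-distribˡ-⊕ : ∀ b (u v : Vec Bool n) → b · (u ⊕ v) ≡ b · u ⊕ b · v
·-distribˡ-⊕ false u v = sym (⊕-self 0ᵥ)
·-distribˡ-⊕ true  u v = refl

Additive : (Vec Bool m → Vec Bool n) → Set
Additive f = ∀ u v → f (u ⊕ v) ≡ f u ⊕ f v

additive⇒0 : {f : Vec Bool m → Vec Bool n} → Additive f → f 0ᵥ ≡ 0ᵥ
additive⇒0 {f = f} f-additive =
  trans (cong f (sym (⊕-self 0ᵥ))) (trans (f-additive 0ᵥ 0ᵥ) (⊕-self (f 0ᵥ)))

additive⇒· : {f : Vec Bool m → Vec Bool n} → Additive f → ∀ b v → f (b · v) ≡ b · f v
additive⇒· f-additive false v = additive⇒0 f-additive
additive⇒· f-additive true  v = refl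

⊕-additive : {f g : Vec Bool m → Vec Bool n} → Additive f → Additive g → Additive (λ v → f v ⊕ g v)
⊕-additive {f = f} {g} f-additive g-additive u v = begin
  f (u ⊕ v) ⊕ g (u ⊕ v)      ≡⟨ cong₂ _⊕_ (f-additive u v) (g-additive u v) ⟩
  (f u ⊕ f v) ⊕ (g u ⊕ g v)  ≡⟨ ⊕-interchange (f u) (f v) (g u) (g v) ⟩
  (f u ⊕ g u) ⊕ (f v ⊕ g v)  ∎
  where open ≡-Reasoning

xor-interchange : ∀ a b c d → (a xor b) xor (c xor d) ≡ (a xor c) xor (b xor d)
xor-interchange = CommutativeSemigroupProperties.interchange
  (CommutativeRing.+-commutativeSemigroup Bool.xor-∧-commutativeRing)

dot : Vec Bool n → Vec Bool n → Bool
dot u v = foldr (λ _ → Bool) _xor_ false (zipWith _∧_ u v)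

infixr 8 _*ᵥ_

_*ᵥ_ : Vec (Vec Bool n) m → Vec Bool n → Vec Bool m
M *ᵥ v = tabulate λ i → dot (lookup M i) v

column : Vec (Vec Bool n) m → Fin n → Vec Bool m
column M j = tabulate λ i → lookup (lookup M i) j

dot-zeroˡ : (v : Vec Bool n) → dot (tabulate λ _ → false) v ≡ false
dot-zeroˡ []      = refl
dot-zeroˡ (x ∷ v) = dot-zeroˡ v

dot-zeroʳ : (u : Vec Bool n) → dot u (tabulate λ _ → false) ≡ false
dot-zeroʳ []      = refl
dot-zeroʳ (x ∷ u) = cong₂ _xor_ (Bool.∧-zeroʳ x) (dot-zeroʳ u)

dot-⊕ʳ : (r u v : Vec Bool n) → dot r (u ⊕ v) ≡ dot r u xor dot r v
dot-⊕ʳ []      []      []      = refl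
dot-⊕ʳ (x ∷ r) (a ∷ u) (b ∷ v) =
  trans (cong₂ _xor_ (Bool.∧-distribˡ-xor x a b) (dot-⊕ʳ r u v))
        (xor-interchange (x ∧ a) (x ∧ b) (dot r u) (dot r v))

dot-tabulate-xor : (f g : Fin n → Bool) (v : Vec Bool n) →
  dot (tabulate λ j → f j xor g j) v ≡ dot (tabulate f) v xor dot (tabulate g) v
dot-tabulate-xor f g []      = refl
dot-tabulate-xor f g (x ∷ v) =
  trans (cong₂ _xor_ (Bool.∧-distribʳ-xor x (f zero) (g zero))
                     (dot-tabulate-xor (λ j → f (suc j)) (λ j → g (suc j)) v))
        (xor-interchange (f zero ∧ x) (g zero ∧ x) _ _)

dot-tabulate-∧ : ∀ b (r v : Vec Bool n) → dot (tabulate λ j → b ∧ lookup r j) v ≡ b ∧ dot r v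
dot-tabulate-∧ b []      []      = sym (Bool.∧-zeroʳ b)
dot-tabulate-∧ b (x ∷ r) (y ∷ v) =
  trans (cong₂ _xor_ (Bool.∧-assoc b x y) (dot-tabulate-∧ b r v))
        (sym (Bool.∧-distribˡ-xor b _ _))

dot-column-*ᵥ : (u : Vec Bool m) (N : Vec (Vec Bool n) m) (v : Vec Bool n) →
  dot (tabulate λ j → dot u (column N j)) v ≡ dot u (N *ᵥ v)
dot-column-*ᵥ []      []      v = dot-zeroˡ v
dot-column-*ᵥ (b ∷ u) (r ∷ N) v =
  trans (dot-tabulate-xor (λ j → b ∧ lookup r j) (λ j → dot u (column N j)) v)
        (cong₂ _xor_ (dot-tabulate-∧ b r v) (dot-column-*ᵥ u N v))

*ᵥ-additive : (M : Vec (Vec Bool n) m) → Additive (M *ᵥ_)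
*ᵥ-additive []      u v = refl
*ᵥ-additive (r ∷ M) u v = cong₂ _∷_ (dot-⊕ʳ r u v) (*ᵥ-additive M u v)

*ᵥ-·₆ : (M N : Mat6) (v : Vec Bool 6) → (M ·₆ N) *ᵥ v ≡ M *ᵥ N *ᵥ v
*ᵥ-·₆ M N v = tabulate-cong λ i →
  trans (cong (λ r → dot r v) (lookup∘tabulate (λ i → tabulate λ j → dot (lookup M i) (column N j)) i))
        (dot-column-*ᵥ (lookup M i) N v)

basis : Fin n → Vec Bool n
basis j = tabulate λ i → δ i j

dot-basisˡ : (i : Fin n) (v : Vec Bool n) → dot (tabulate (δ i)) v ≡ lookup v i
dot-basisˡ zero    (x ∷ v) = trans (cong (x xor_) (dot-zeroˡ v)) (Bool.xor-identityʳ x)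
dot-basisˡ (suc i) (x ∷ v) = dot-basisˡ i v

dot-basisʳ : (r : Vec Bool n) (j : Fin n) → dot r (basis j) ≡ lookup r j
dot-basisʳ (x ∷ r) zero    =
  trans (cong₂ _xor_ (Bool.∧-identityʳ x) (dot-zeroʳ r)) (Bool.xor-identityʳ x)
dot-basisʳ (x ∷ r) (suc j) = trans (cong (_xor dot r (basis j)) (Bool.∧-zeroʳ x)) (dot-basisʳ r j)

I₆-*ᵥ : (v : Vec Bool 6) → I₆ *ᵥ v ≡ v
I₆-*ᵥ v = trans
  (tabulate-cong λ i → trans (cong (λ r → dot r v) (lookup∘tabulate (λ i → tabulate (δ i)) i))
                             (dot-basisˡ i v))
  (tabulate∘lookup v)

lookup-*ᵥ-basis : (M : Vec (Vec Bool n) m) (i : Fin m) (j : Fin n) →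
  lookup (M *ᵥ basis j) i ≡ lookup (lookup M i) j
lookup-*ᵥ-basis M i j =
  trans (lookup∘tabulate (λ i → dot (lookup M i) (basis j)) i) (dot-basisʳ (lookup M i) j)

*ᵥ-extensional : (M N : Vec (Vec Bool n) m) → (∀ v → M *ᵥ v ≡ N *ᵥ v) → M ≡ N
*ᵥ-extensional M N M≗N = begin
  M                  ≡⟨ tabulate∘lookup M ⟨
  tabulate (lookup M) ≡⟨ tabulate-cong row ⟩
  tabulate (lookup N) ≡⟨ tabulate∘lookup N ⟩
  N                  ∎
  where
  open ≡-Reasoning
  entry : ∀ i j → lookup (lookup M i) j ≡ lookup (lookup N i) j
  entry i j = trans (sym (lookup-*ᵥ-basis M i j))
                    (trans (cong (λ w → lookup w i) (M≗N (basis j))) (lookup-*ᵥ-basis N i j))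
  row : ∀ i → lookup M i ≡ lookup N i
  row i = trans (sym (tabulate∘lookup (lookup M i)))
                (trans (tabulate-cong (entry i)) (tabulate∘lookup (lookup N i)))

Vec-Bool↔Fin : Vec Bool n ↔ Fin (2 ℕ.^ n)
Vec-Bool↔Fin {n} = mk↔ₛ′ toFin (fromFin {n}) (toFin∘fromFin {n}) fromFin∘toFin
  where
  bit : Bool → Fin 2
  bit false = zero
  bit true  = suc zero

  fromBit : Fin 2 → Bool
  fromBit zero       = false
  fromBit (suc zero) = true

  bit∘fromBit : ∀ i → bit (fromBit i) ≡ i
  bit∘fromBit zero       = refl
  bit∘fromBit (suc zero) = refl

  fromBit∘bit : ∀ b → fromBit (bit b) ≡ b
  fromBit∘bit false = refl
  fromBit∘bit true  = refl

  toFin : ∀ {l} → Vec Bool l → Fin (2 ℕ.^ l)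
  toFin []      = zero
  toFin (b ∷ v) = combine (bit b) (toFin v)

  fromFin : ∀ {l} → Fin (2 ℕ.^ l) → Vec Bool l
  fromFin {zero}  i = []
  fromFin {suc l} i = fromBit (proj₁ (remQuot (2 ℕ.^ l) i)) ∷ fromFin {l} (proj₂ (remQuot (2 ℕ.^ l) i))

  toFin∘fromFin : ∀ {l} (i : Fin (2 ℕ.^ l)) → toFin (fromFin {l} i) ≡ i
  toFin∘fromFin {zero}  zero = refl
  toFin∘fromFin {suc l} i    =
    trans (cong₂ combine (bit∘fromBit (proj₁ q)) (toFin∘fromFin {l} (proj₂ q)))
          (Fin.combine-remQuot {2} (2 ℕ.^ l) i)
    where q = remQuot {2} (2 ℕ.^ l) i

  fromFin∘toFin : ∀ {l} (v : Vec Bool l) → fromFin (toFin v) ≡ v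
  fromFin∘toFin         []      = refl
  fromFin∘toFin {suc l} (b ∷ v) = cong₂ _∷_
    (trans (cong (fromBit ∘ proj₁) (Fin.remQuot-combine (bit b) (toFin v))) (fromBit∘bit b))
    (trans (cong (fromFin {l} ∘ proj₂) (Fin.remQuot-combine (bit b) (toFin v))) (fromFin∘toFin v))

module Finite {A : Set} {k : ℕ} (A↔Fin : A ↔ Fin k) where
  open Inverse A↔Fin using (to; from; strictlyInverseˡ; strictlyInverseʳ)

  all? : {P : A → Set} → Decidable P → Dec (∀ x → P x)
  all? {P} P? = map′ (λ ∀P∘from x → subst P (strictlyInverseʳ x) (∀P∘from (to x)))
                     (λ ∀P i → ∀P (from i))
                     (Fin.all? (P? ∘ from))

  any? : {P : A → Set} → Decidable P → Dec (∃ P)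
  any? {P} P? = map′ (λ (i , p) → from i , p)
                     (λ (x , p) → to x , subst P (sym (strictlyInverseʳ x)) p)
                     (Fin.any? (P? ∘ from))

  by-exhaustion : {P : A → Set} (P? : Decidable P) → {True (all? P?)} → ∀ x → P x
  by-exhaustion P? {∀P} = toWitness ∀P

  ¬∀⇒∃¬ : {P : A → Set} → Decidable P → ¬ (∀ x → P x) → ∃ λ x → ¬ P x
  ¬∀⇒∃¬ {P} P? ¬∀P =
    let i , ¬Pi = Fin.¬∀⟶∃¬ k (P ∘ from) (P? ∘ from)
                    (λ ∀P∘from → ¬∀P λ x → subst P (strictlyInverseʳ x) (∀P∘from (to x)))
    in from i , ¬Pi

  to-injective : ∀ {x y} → to x ≡ to y → x ≡ y
  to-injective {x} {y} eq = trans (sym (strictlyInverseʳ x)) (trans (cong from eq) (strictlyInverseʳ y))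

  from-injective : ∀ {i j} → from i ≡ from j → i ≡ j
  from-injective {i} {j} eq = trans (sym (strictlyInverseˡ i)) (trans (cong to eq) (strictlyInverseˡ j))

  injective⇒surjective : (f : A → A) → (∀ {x y} → f x ≡ f y → x ≡ y) → ∀ y → ∃ λ x → f x ≡ y
  injective⇒surjective f f-injective y with Fin.pigeonhole (n<1+n k) code
    where
    code : Fin (suc k) → Fin k
    code zero    = to y
    code (suc i) = to (f (from i))
  ... | zero  , suc j , _   , y≡fx   = from j , sym (to-injective y≡fx)
  ... | suc i , suc j , i<j , fx≡fx′ =
    ⊥-elim (Fin.<-irrefl (cong suc (from-injective (f-injective (to-injective fx≡fx′)))) i<j)

poly : Vec Bool k → (Vec Bool n → Vec Bool n) → Vec Bool n → Vec Bool n
poly []      f x = 0ᵥ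
poly (b ∷ a) f x = b · x ⊕ poly a f (f x)

poly-natural : {f : Vec Bool m → Vec Bool m} {g : Vec Bool n → Vec Bool n} {ψ : Vec Bool m → Vec Bool n} →
  Additive ψ → (∀ v → ψ (f v) ≡ g (ψ v)) → (a : Vec Bool k) (x : Vec Bool m) →
  ψ (poly a f x) ≡ poly a g (ψ x)
poly-natural ψ-additive ψf≡gψ []      x = additive⇒0 ψ-additive
poly-natural {f = f} {g} {ψ} ψ-additive ψf≡gψ (b ∷ a) x = begin
  ψ (b · x ⊕ poly a f (f x))         ≡⟨ ψ-additive _ _ ⟩
  ψ (b · x) ⊕ ψ (poly a f (f x))     ≡⟨ cong₂ _⊕_ (additive⇒· ψ-additive b x) (poly-natural ψ-additive ψf≡gψ a (f x)) ⟩
  b · ψ x ⊕ poly a g (ψ (f x))       ≡⟨ cong (λ y → b · ψ x ⊕ poly a g y) (ψf≡gψ x) ⟩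
  b · ψ x ⊕ poly a g (g (ψ x))       ∎
  where open ≡-Reasoning

poly-⊕ : (f : Vec Bool n → Vec Bool n) (a c : Vec Bool k) (x : Vec Bool n) →
  poly (a ⊕ c) f x ≡ poly a f x ⊕ poly c f x
poly-⊕ f []      []      x = sym (⊕-self 0ᵥ)
poly-⊕ f (b ∷ a) (d ∷ c) x = begin
  (b xor d) · x ⊕ poly (a ⊕ c) f (f x)                 ≡⟨ cong₂ _⊕_ (·-distribʳ-xor b d x) (poly-⊕ f a c (f x)) ⟩
  (b · x ⊕ d · x) ⊕ (poly a f (f x) ⊕ poly c f (f x))  ≡⟨ ⊕-interchange (b · x) (d · x) _ _ ⟩
  (b · x ⊕ poly a f (f x)) ⊕ (d · x ⊕ poly c f (f x))  ∎
  where open ≡-Reasoning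

poly-0ᵥ : {f : Vec Bool n → Vec Bool n} → Additive f → (a : Vec Bool k) → poly a f 0ᵥ ≡ 0ᵥ
poly-0ᵥ f-additive []      = refl
poly-0ᵥ {f = f} f-additive (b ∷ a) = trans
  (cong₂ _⊕_ (Bool.if-eta b) (trans (cong (poly a f) (additive⇒0 f-additive)) (poly-0ᵥ f-additive a)))
  (⊕-self 0ᵥ)

-- The field F₂[X]/(X⁶ + X³ + 1)

V : Set
V = Vec Bool 6

open Finite (Vec-Bool↔Fin {6}) using (by-exhaustion; any?; ¬∀⇒∃¬; injective⇒surjective)

infix 4 _≟_

_≟_ : (u v : V) → Dec (u ≡ v)
_≟_ = ≡-dec Bool._≟_

-- Coordinates are the coefficients of 1, X, …, X⁵; the reduction uses X⁶ = X³ + 1.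
mulX : V → V
mulX (r₀ ∷ r₁ ∷ r₂ ∷ r₃ ∷ r₄ ∷ r₅ ∷ []) = r₅ ∷ r₀ ∷ r₁ ∷ (r₂ xor r₅) ∷ r₃ ∷ r₄ ∷ []

one : V
one = true ∷ false ∷ false ∷ false ∷ false ∷ false ∷ []

Invertible : V → Set
Invertible t = Σ V λ a → poly a mulX t ≡ one

-- Opaque: unfolding the exhaustive searches during unification is prohibitively slow.
opaque
  ≡0⊎invertible : ∀ t → t ≡ 0ᵥ ⊎ Invertible t
  ≡0⊎invertible = by-exhaustion λ t → t ≟ 0ᵥ ⊎-dec invertible? t
    where
    invertible? : Decidable Invertible
    invertible? t = any? λ a → poly a mulX t ≟ one

  mulX³-fixed⇒0 : ∀ r → (mulX ^ 3) r ≡ r → r ≡ 0ᵥ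
  mulX³-fixed⇒0 = by-exhaustion λ r → (mulX ^ 3) r ≟ r →-dec r ≟ 0ᵥ

-- Additive maps of F₂⁶ annihilated by the cyclotomic polynomial Φ₉ = X⁶ + X³ + 1

Φ₉ : (V → V) → V → V
Φ₉ h v = (h ^ 6) v ⊕ ((h ^ 3) v ⊕ v)

module ⊕-Solver = CommutativeMonoidSolver (⊕-commutativeMonoid 6)

module _ {h : V → V} (h-additive : Additive h) where

  ^-additive : ∀ k → Additive (h ^ k)
  ^-additive zero    u v = refl
  ^-additive (suc k) u v = trans (cong h (^-additive k u v)) (h-additive _ _)

  Φ₉-additive : Additive (Φ₉ h)
  Φ₉-additive = ⊕-additive (^-additive 6) (⊕-additive (^-additive 3) λ _ _ → refl)

  ^3-Φ₉-comm : ∀ v → (h ^ 3) (Φ₉ h v) ≡ Φ₉ h ((h ^ 3) v)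
  ^3-Φ₉-comm v = trans (^-additive 3 _ _) (cong ((h ^ 9) v ⊕_) (^-additive 3 _ _))

  -- (X³ + 1) Φ₉ = X⁹ + 1
  Φ₉-telescope : ∀ z → Φ₉ h ((h ^ 3) z) ⊕ Φ₉ h z ≡ (h ^ 9) z ⊕ z
  Φ₉-telescope z = begin
    (h⁹z ⊕ (h⁶z ⊕ h³z)) ⊕ (h⁶z ⊕ (h³z ⊕ z))
      ≡⟨ ⊕-Solver.solve 4
           (λ a b c d → (a ⊕ₑ (b ⊕ₑ c)) ⊕ₑ (b ⊕ₑ (c ⊕ₑ d)) ⊜ (a ⊕ₑ d) ⊕ₑ ((b ⊕ₑ b) ⊕ₑ (c ⊕ₑ c)))
           refl h⁹z h⁶z h³z z ⟩
    (h⁹z ⊕ z) ⊕ ((h⁶z ⊕ h⁶z) ⊕ (h³z ⊕ h³z))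
      ≡⟨ cong ((h⁹z ⊕ z) ⊕_) (cong₂ _⊕_ (⊕-self h⁶z) (⊕-self h³z)) ⟩
    (h⁹z ⊕ z) ⊕ (0ᵥ ⊕ 0ᵥ)
      ≡⟨ ⊕-identityʳ (h⁹z ⊕ z) ⟩
    h⁹z ⊕ z ∎
    where
    open ≡-Reasoning
    open ⊕-Solver using (_⊜_) renaming (_⊕_ to _⊕ₑ_)
    h⁹z = (h ^ 9) z
    h⁶z = (h ^ 6) z
    h³z = (h ^ 3) z

  module Cyclic (x : V) (x≢0 : x ≢ 0ᵥ) (Φ₉x≡0 : Φ₉ h x ≡ 0ᵥ) where

    combination : V → V
    combination r = poly r h x

    combination-additive : Additive combination
    combination-additive r s = poly-⊕ h r s x

    combination-mulX : ∀ r → combination (mulX r) ≡ h (combination r)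
    combination-mulX r@(r₀ ∷ r₁ ∷ r₂ ∷ r₃ ∷ r₄ ∷ r₅ ∷ []) = begin
      r₅ · x ⊕ (A₀ ⊕ (A₁ ⊕ ((r₂ xor r₅) · h³x ⊕ (A₃ ⊕ (A₄ ⊕ 0ᵥ)))))
        ≡⟨ cong (λ y → r₅ · x ⊕ (A₀ ⊕ (A₁ ⊕ (y ⊕ (A₃ ⊕ (A₄ ⊕ 0ᵥ)))))) (·-distribʳ-xor r₂ r₅ h³x) ⟩
      r₅ · x ⊕ (A₀ ⊕ (A₁ ⊕ ((A₂ ⊕ r₅ · h³x) ⊕ (A₃ ⊕ (A₄ ⊕ 0ᵥ)))))
        ≡⟨ ⊕-Solver.solve 7
             (λ a₀ a₁ a₂ a₃ a₄ p q →
               q ⊕ₑ (a₀ ⊕ₑ (a₁ ⊕ₑ ((a₂ ⊕ₑ p) ⊕ₑ (a₃ ⊕ₑ (a₄ ⊕ₑ id)))))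
               ⊜ a₀ ⊕ₑ (a₁ ⊕ₑ (a₂ ⊕ₑ (a₃ ⊕ₑ (a₄ ⊕ₑ ((p ⊕ₑ q) ⊕ₑ id))))))
             refl A₀ A₁ A₂ A₃ A₄ (r₅ · h³x) (r₅ · x) ⟩
      A₀ ⊕ (A₁ ⊕ (A₂ ⊕ (A₃ ⊕ (A₄ ⊕ (r₅ · h³x ⊕ r₅ · x ⊕ 0ᵥ)))))
        ≡⟨ cong (λ y → A₀ ⊕ (A₁ ⊕ (A₂ ⊕ (A₃ ⊕ (A₄ ⊕ (y ⊕ 0ᵥ))))))
                (trans (sym (·-distribˡ-⊕ r₅ h³x x)) (cong (r₅ ·_) (sym h⁶x≡h³x⊕x))) ⟩
      poly r h (h x)
        ≡⟨ poly-natural {f = h} {g = h} h-additive (λ _ → refl) r x ⟨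
      h (combination r) ∎
      where
      open ≡-Reasoning
      open ⊕-Solver using (_⊜_; id) renaming (_⊕_ to _⊕ₑ_)
      h³x = (h ^ 3) x
      A₀ = r₀ · h x
      A₁ = r₁ · (h ^ 2) x
      A₂ = r₂ · h³x
      A₃ = r₃ · (h ^ 4) x
      A₄ = r₄ · (h ^ 5) x
      h⁶x≡h³x⊕x : (h ^ 6) x ≡ h³x ⊕ x
      h⁶x≡h³x⊕x = ⊕≡0⇒≡ _ _ Φ₉x≡0

    combination-mulX^ : ∀ k r → combination ((mulX ^ k) r) ≡ (h ^ k) (combination r)
    combination-mulX^ zero    r = refl
    combination-mulX^ (suc k) r = trans (combination-mulX ((mulX ^ k) r)) (cong h (combination-mulX^ k r))

    combination-injective : ∀ {r s} → combination r ≡ combination s → r ≡ s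
    combination-injective {r} {s} eq with ≡0⊎invertible (r ⊕ s)
    ... | inj₁ r⊕s≡0       = ⊕≡0⇒≡ r s r⊕s≡0
    ... | inj₂ (a , a[r⊕s]≡1) = ⊥-elim (x≢0 (begin
      x                                 ≡⟨ ⊕-identityʳ x ⟨
      combination one                   ≡⟨ cong combination a[r⊕s]≡1 ⟨
      combination (poly a mulX (r ⊕ s)) ≡⟨ poly-natural {f = mulX} {g = h} {ψ = combination} combination-additive combination-mulX a (r ⊕ s) ⟩
      poly a h (combination (r ⊕ s))    ≡⟨ cong (poly a h) combination[r⊕s]≡0 ⟩
      poly a h 0ᵥ                       ≡⟨ poly-0ᵥ h-additive a ⟩
      0ᵥ                                ∎))
      where
      open ≡-Reasoning
      combination[r⊕s]≡0 : combination (r ⊕ s) ≡ 0ᵥ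
      combination[r⊕s]≡0 = trans (combination-additive r s)
                                 (trans (cong (_⊕ combination s) eq) (⊕-self (combination s)))

    combination-surjective : ∀ v → ∃ λ r → combination r ≡ v
    combination-surjective = injective⇒surjective combination combination-injective

  order-9⇒Φ₉≡0 : (∀ v → (h ^ 9) v ≡ v) → ¬ (∀ v → (h ^ 3) v ≡ v) → ∀ v → Φ₉ h v ≡ 0ᵥ
  order-9⇒Φ₉≡0 h⁹≡id h³≢id u = begin
    Φ₉ h u         ≡⟨ combination[r]≡Φ₉u ⟨
    combination r  ≡⟨ cong combination (mulX³-fixed⇒0 r mulX³r≡r) ⟩
    combination 0ᵥ ≡⟨⟩
    0ᵥ             ∎
    where
    open ≡-Reasoning
    z,h³z≢z = ¬∀⇒∃¬ (λ v → (h ^ 3) v ≟ v) h³≢id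
    z = proj₁ z,h³z≢z
    y = (h ^ 3) z ⊕ z

    Φ₉y≡0 : Φ₉ h y ≡ 0ᵥ
    Φ₉y≡0 = trans (Φ₉-additive _ _)
                  (trans (Φ₉-telescope z) (trans (cong (_⊕ z) (h⁹≡id z)) (⊕-self z)))

    open Cyclic y (λ y≡0 → proj₂ z,h³z≢z (⊕≡0⇒≡ _ _ y≡0)) Φ₉y≡0

    h³Φ₉u≡Φ₉u : (h ^ 3) (Φ₉ h u) ≡ Φ₉ h u
    h³Φ₉u≡Φ₉u = ⊕≡0⇒≡ _ _
      (trans (cong (_⊕ Φ₉ h u) (^3-Φ₉-comm u))
             (trans (Φ₉-telescope u) (trans (cong (_⊕ u) (h⁹≡id u)) (⊕-self u))))

    r = proj₁ (combination-surjective (Φ₉ h u))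
    combination[r]≡Φ₉u = proj₂ (combination-surjective (Φ₉ h u))

    mulX³r≡r : (mulX ^ 3) r ≡ r
    mulX³r≡r = combination-injective (begin
      combination ((mulX ^ 3) r) ≡⟨ combination-mulX^ 3 r ⟩
      (h ^ 3) (combination r)    ≡⟨ cong (h ^ 3) combination[r]≡Φ₉u ⟩
      (h ^ 3) (Φ₉ h u)           ≡⟨ h³Φ₉u≡Φ₉u ⟩
      Φ₉ h u                     ≡⟨ combination[r]≡Φ₉u ⟨
      combination r              ∎)

  Φ₉≡0⇒central-involution-trivial : (∀ v → Φ₉ h v ≡ 0ᵥ) →
    {c : V → V} → Additive c → (∀ v → c (c v) ≡ v) → (∀ v → c (h v) ≡ h (c v)) →
    ∀ v → c v ≡ v
  Φ₉≡0⇒central-involution-trivial Φ₉≡0 {c} c-additive c²≡id ch≡hc u with c u ⊕ u ≟ 0ᵥ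
  ... | yes cu⊕u≡0 = ⊕≡0⇒≡ _ _ cu⊕u≡0
  ... | no  cu⊕u≢0 = ⊥-elim (cu⊕u≢0 (begin
    c u ⊕ u                    ≡⟨ cong (λ v → c v ⊕ v) combination[r]≡u ⟨
    c⊕id (combination r)       ≡⟨ poly-natural {f = h} {g = h} {ψ = c⊕id} c⊕id-additive c⊕id-commutes r x ⟩
    poly r h (c⊕id x)          ≡⟨ cong (poly r h) c⊕id[x]≡0 ⟩
    poly r h 0ᵥ                ≡⟨ poly-0ᵥ h-additive r ⟩
    0ᵥ                         ∎))
    where
    open ≡-Reasoning
    x = c u ⊕ u
    open Cyclic x cu⊕u≢0 (Φ₉≡0 x)

    c⊕id : V → V
    c⊕id v = c v ⊕ v

    c⊕id-additive : Additive c⊕id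
    c⊕id-additive = ⊕-additive c-additive λ _ _ → refl

    c⊕id-commutes : ∀ v → c⊕id (h v) ≡ h (c⊕id v)
    c⊕id-commutes v = trans (cong (_⊕ h v) (ch≡hc v)) (sym (h-additive (c v) v))

    c⊕id[x]≡0 : c⊕id x ≡ 0ᵥ
    c⊕id[x]≡0 = begin
      c (c u ⊕ u) ⊕ (c u ⊕ u)   ≡⟨ cong (_⊕ x) (c-additive (c u) u) ⟩
      (c (c u) ⊕ c u) ⊕ (c u ⊕ u) ≡⟨ cong (λ v → (v ⊕ c u) ⊕ x) (c²≡id u) ⟩
      (u ⊕ c u) ⊕ (c u ⊕ u)     ≡⟨ cong (_⊕ x) (⊕-comm u (c u)) ⟩
      x ⊕ x                     ≡⟨ ⊕-self x ⟩
      0ᵥ                        ∎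

    r = proj₁ (combination-surjective u)
    combination[r]≡u = proj₂ (combination-surjective u)

-- Linear representations of SL₂(F₈) × C₂ on F₂⁶

^-cong : {f g : V → V} → (∀ v → f v ≡ g v) → ∀ k v → (f ^ k) v ≡ (g ^ k) v
^-cong         f≗g zero    v = refl
^-cong {f} {g} f≗g (suc k) v = trans (f≗g ((f ^ k) v)) (cong g (^-cong f≗g k v))

idempotent-invertible⇒identity : (M N : Mat6) → M ·₆ M ≡ M → M ·₆ N ≡ I₆ → ∀ v → M *ᵥ v ≡ v
idempotent-invertible⇒identity M N M²≡M MN≡I v = begin
  M *ᵥ v              ≡⟨ cong (M *ᵥ_) N-right-inverse ⟨
  M *ᵥ M *ᵥ N *ᵥ v    ≡⟨ *ᵥ-·₆ M M (N *ᵥ v) ⟨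
  (M ·₆ M) *ᵥ N *ᵥ v  ≡⟨ cong (λ P → P *ᵥ N *ᵥ v) M²≡M ⟩
  M *ᵥ N *ᵥ v         ≡⟨ *ᵥ-·₆ M N v ⟨
  (M ·₆ N) *ᵥ v       ≡⟨ cong (_*ᵥ v) MN≡I ⟩
  I₆ *ᵥ v             ≡⟨ I₆-*ᵥ v ⟩
  v                   ∎
  where
  open ≡-Reasoning
  N-right-inverse : M *ᵥ N *ᵥ v ≡ v
  N-right-inverse = trans (sym (*ᵥ-·₆ M N v)) (trans (cong (_*ᵥ v) MN≡I) (I₆-*ᵥ v))

I₂ : M2
I₂ = mat2 1F8 0F8 0F8 1F8

cube : M2 → M2
cube A = A ·₂ (A ·₂ A)

module Representation (emb : EmbeddingIntoGL6) where
  open EmbeddingIntoGL6 emb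

  -- Opaque, so that iterates of ρ A s are compared without unfolding the matrix action.
  opaque
    ρ : M2 → Bool → V → V
    ρ A s v = φ A s *ᵥ v

    ρ-additive : ∀ {A s} → Additive (ρ A s)
    ρ-additive {A} {s} = *ᵥ-additive (φ A s)

    ρ-hom : ∀ {A B s t} → IsSL2 A → IsSL2 B → ∀ v → ρ (A ·₂ B) (s xor t) v ≡ ρ A s (ρ B t v)
    ρ-hom {A} {B} {s} {t} A∈SL₂ B∈SL₂ v =
      trans (cong (_*ᵥ v) (φ-hom A B s t A∈SL₂ B∈SL₂)) (*ᵥ-·₆ (φ A s) (φ B t) v)

    ρ-identity : ∀ v → ρ I₂ false v ≡ v
    ρ-identity = idempotent-invertible⇒identity (φ I₂ false) (proj₁ (φ-GL I₂ false refl))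
      (sym (φ-hom I₂ I₂ false false refl refl)) (proj₁ (proj₂ (φ-GL I₂ false refl)))

    ρ-faithful : ∀ {A s} → IsSL2 A → (∀ v → ρ A s v ≡ v) → (A ≈PSL I₂) × (s ≡ false)
    ρ-faithful {A} {s} A∈SL₂ ρAs≗id = φ-inj A I₂ s false A∈SL₂ refl
      (*ᵥ-extensional (φ A s) (φ I₂ false) λ v → trans (ρAs≗id v) (sym (ρ-identity v)))

  ρ-cube : ∀ {A} → IsSL2 A → IsSL2 (A ·₂ A) → ∀ v → ρ (cube A) false v ≡ (ρ A false ^ 3) v
  ρ-cube A∈SL₂ A²∈SL₂ v =
    trans (ρ-hom A∈SL₂ A²∈SL₂ v) (cong (ρ _ false) (ρ-hom A∈SL₂ A∈SL₂ v))

g₉ g₃ : M2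
g₉ = mat2 (false , false , false) (false , false , true) (true , true , true) (false , false , true)
g₃ = mat2 (false , false , true) (true , false , false) (true , true , false) (true , false , true)

cube-g₉ : cube g₉ ≡ g₃
cube-g₉ = refl

cube-g₃ : cube g₃ ≡ I₂
cube-g₃ = refl

g₃≉I₂ : ¬ (g₃ ≈PSL I₂)
g₃≉I₂ (inj₁ ())
g₃≉I₂ (inj₂ ())

lemma3p21 : ¬ EmbeddingIntoGL6
lemma3p21 emb = true≢false (proj₂ (ρ-faithful refl c≗id))
  where
  open Representation emb
  h c : V → V
  h = ρ g₉ false
  c = ρ I₂ true

  h³≗ρg₃ : ∀ v → (h ^ 3) v ≡ ρ g₃ false v
  h³≗ρg₃ v = trans (sym (ρ-cube refl refl v)) (cong (λ A → ρ A false v) cube-g₉)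

  h⁹≗id : ∀ v → (h ^ 9) v ≡ v
  h⁹≗id v = begin
    (h ^ 9) v              ≡⟨ ^-cong h³≗ρg₃ 3 v ⟩
    (ρ g₃ false ^ 3) v     ≡⟨ ρ-cube refl refl v ⟨
    ρ (cube g₃) false v    ≡⟨ cong (λ A → ρ A false v) cube-g₃ ⟩
    ρ I₂ false v           ≡⟨ ρ-identity v ⟩
    v                      ∎
    where open ≡-Reasoning

  h³≢id : ¬ (∀ v → (h ^ 3) v ≡ v)
  h³≢id h³≗id = g₃≉I₂ (proj₁ (ρ-faithful refl λ v → trans (sym (h³≗ρg₃ v)) (h³≗id v)))

  c≗id : ∀ v → c v ≡ v
  c≗id = Φ₉≡0⇒central-involution-trivial ρ-additive
    (order-9⇒Φ₉≡0 ρ-additive h⁹≗id h³≢id) ρ-additive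
    (λ v → trans (sym (ρ-hom refl refl v)) (ρ-identity v))
    (λ v → trans (sym (ρ-hom {I₂} {g₉} {true} {false} refl refl v)) (ρ-hom {g₉} {I₂} {false} {true} refl refl v))

  true≢false : true ≢ false
  true≢false ()
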